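{- Let $r\ge 3$ be an integer, and let $n,k$ be integers with $n>2k$ and $k\ge r$. Suppose that $\mathcal A\subset\binom{[2,n]}{k-1}$ and $\mathcal B\subset\binom{[2,n]}{k}$ are cross-intersecting. If $|\mathcal A|\ge\binom{n-1}{k-1}-\binom{n-r}{k-1}$, then $|\mathcal B|\le\binom{n-r}{k-r+1}$.
   Context: $[2,n]=\{2,3,\dots,n\}$ and $\binom{X}{j}$ denotes the set of $j$-element subsets of $X$. Two families $\mathcal A,\mathcal B$ are cross-intersecting if $A\cap B\neq\emptyset$ for all $A\in\mathcal A$, $B\in\mathcal B$. -}

module Defs where

open import Data.Nat using (ℕ; _≤_; _∸_)
open import Data.Fin using (Fin; toℕ)
open import Data.Fin.Subset using (Subset; _∈_; ∣_∣; _∩_; Nonempty)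
open import Data.List using (List)
open import Data.Product using (_×_)
open import Relation.Binary.PropositionalEquality using (_≡_)
open import Data.List.Relation.Unary.All using (All)
open import Data.List.Relation.Unary.Unique.Propositional using (Unique)
open import Data.List.Membership.Propositional renaming (_∈_ to _∈ₗ_)

-- The ground set [n] = {1,…,n} is modelled as Fin n, where i : Fin n
-- stands for the integer toℕ i + 1.  Hence [2,n] = {2,…,n} corresponds to
-- the elements i with 1 ≤ toℕ i.

InBinom2n : (n j : ℕ) → Subset n → Set
InBinom2n n j A = (∀ (i : Fin n) → i ∈ A → 1 ≤ toℕ i) × ∣ A ∣ ≡ j

-- A family 𝒜 ⊆ binom([2,n], j), given as a duplicate-free list of subsets
-- (so its cardinality |𝒜| is the length of the list).
FamilyIn : (n j : ℕ) → List (Subset n) → Set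
FamilyIn n j 𝒜 = Unique 𝒜 × All (InBinom2n n j) 𝒜

CrossIntersecting : {n : ℕ} → List (Subset n) → List (Subset n) → Set
CrossIntersecting 𝒜 ℬ = ∀ {A B} → A ∈ₗ 𝒜 → B ∈ₗ ℬ → Nonempty (A ∩ B)

-- Taking complements in [2,n], the members of ℬ become a family F of (n-1-k)-sets, and
-- cross-intersection says that no member of 𝒜 lies inside a member of F, so 𝒜 is disjoint
-- from the (k-1)-shadow of F. If |ℬ| = |F| exceeded C(n-r, n-1-k) = C(n-r, k-r+1), Lovász's
-- version of the Kruskal–Katona theorem would make that shadow larger than C(n-r, k-1),
-- leaving fewer than C(n-1, k-1) - C(n-r, k-1) sets for 𝒜. Lovász's theorem is proved by
-- Frankl's shifting argument: compressions towards one element preserve the size of a family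
-- and do not enlarge its shadow, and for a shifted family the shadow splits along that element.
module Submission where

open import Defs
open import Data.Nat using (ℕ; _≤_; _<_; _*_; _∸_; _+_)
open import Data.Nat.Combinatorics using (_C_)
open import Data.Fin.Subset using (Subset)
open import Data.List using (List; length)

open import Data.Bool using (Bool; true; false; not; _∧_; _∨_; if_then_else_; T)
import Data.Bool as Bool
open import Data.Bool.Properties using (T-∧; T-∨; T?)
open import Data.Empty using (⊥; ⊥-elim)
open import Data.Fin using (Fin; zero; suc)
import Data.Fin.Properties as Fin
open import Data.Fin.Subset using (∣_∣; ∁; _⊆_)
open import Data.Fin.Subset.Properties using (∣∁p∣≡n∸∣p∣; ∣p∣≤n; x∈∁p⇒x∉p; x∈p∩q⁻)
open import Data.List using ([]; _∷_)
open import Data.List.Membership.Propositional using () renaming (_∈_ to _∈ₗ_)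
import Data.List.Relation.Unary.All as All
import Data.List.Relation.Unary.Any as Any
open import Data.List.Relation.Unary.AllPairs using ([]; _∷_)
open import Data.List.Relation.Unary.Unique.Propositional using (Unique)
open import Data.Nat using (zero; suc; z≤n; s≤s; s≤s⁻¹; _≡ᵇ_)
open import Data.Nat.Combinatorics using (nCk+nC[k+1]≡[n+1]C[k+1]; nCk≡nC[n∸k])
open import Data.Nat.Induction using (<-wellFounded)
open import Data.Nat.Properties
open import Algebra.Properties.CommutativeSemigroup +-commutativeSemigroup using (interchange)
open import Data.Product using (∃; _×_; _,_; proj₁; proj₂)
open import Data.Sum using (_⊎_; inj₁; inj₂; map₂)
open import Data.Vec using (Vec; []; _∷_; lookup; _[_]≔_; insertAt; here; there)
open import Data.Vec.Properties
  using (≡-dec; insertAt-lookup; lookup∘update; lookup∘update′; []≔-idempotent; []≔-commutes;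
         []≔-lookup; []≔-updates; []≔-minimal)
open import Function using (_∘_; id; Equivalence)
open import Induction.WellFounded using (Acc; acc)
open import Relation.Binary.Definitions using (DecidableEquality)
open import Relation.Binary.PropositionalEquality
open import Relation.Nullary using (¬_; Dec; yes; no)
open import Relation.Nullary.Decidable using (decidable-stable; does)

open Equivalence using (to; from)

[]≔-restore : ∀ {a} {A : Set a} {n} (xs : Vec A n) i {x y} → lookup xs i ≡ y →
              (xs [ i ]≔ x) [ i ]≔ y ≡ xs
[]≔-restore xs i refl = trans ([]≔-idempotent xs i) ([]≔-lookup xs i)

insertAt-[]≔ : ∀ {a} {A : Set a} {n} (xs : Vec A n) i {x y} → insertAt xs i x [ i ]≔ y ≡ insertAt xs i y
insertAt-[]≔ xs       zero    = refl
insertAt-[]≔ (z ∷ xs) (suc i) = cong (z ∷_) (insertAt-[]≔ xs i)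

≢-by-lookup : ∀ {m} (t : Subset m) {i j} → lookup t i ≡ false → lookup t j ≡ true → i ≢ j
≢-by-lookup t tᵢ tⱼ refl with () ← trans (sym tᵢ) tⱼ

∣p[i]≔true∣ : ∀ {m} (p : Subset m) i → lookup p i ≡ false → ∣ p [ i ]≔ true ∣ ≡ suc ∣ p ∣
∣p[i]≔true∣ (false ∷ p) zero    refl = refl
∣p[i]≔true∣ (true  ∷ p) (suc i) pᵢ   = cong suc (∣p[i]≔true∣ p i pᵢ)
∣p[i]≔true∣ (false ∷ p) (suc i) pᵢ   = ∣p[i]≔true∣ p i pᵢ

∣p∣≡1+n⇒lookup : ∀ {m n} (p : Subset m) → ∣ p ∣ ≡ suc n → ∃ λ i → lookup p i ≡ true
∣p∣≡1+n⇒lookup (true  ∷ p) _ = zero , refl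
∣p∣≡1+n⇒lookup (false ∷ p) e = let (i , pᵢ) = ∣p∣≡1+n⇒lookup p e in suc i , pᵢ

p⊆p[i]≔true : ∀ {m} (p : Subset m) i → p ⊆ p [ i ]≔ true
p⊆p[i]≔true p i {x} x∈p with x Fin.≟ i
... | yes refl = []≔-updates p i
... | no  x≢i  = []≔-minimal p x i x≢i x∈p

∑ : ∀ {m} → (Subset m → ℕ) → ℕ
∑ {zero}  f = f []
∑ {suc m} f = ∑ (λ t → f (false ∷ t)) + ∑ (λ t → f (true ∷ t))

∑-cong : ∀ {m} {f g : Subset m → ℕ} → (∀ S → f S ≡ g S) → ∑ f ≡ ∑ g
∑-cong {zero}  f≗g = f≗g []
∑-cong {suc m} f≗g = cong₂ _+_ (∑-cong (f≗g ∘ (false ∷_))) (∑-cong (f≗g ∘ (true ∷_)))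

∑-mono-≤ : ∀ {m} {f g : Subset m → ℕ} → (∀ S → f S ≤ g S) → ∑ f ≤ ∑ g
∑-mono-≤ {zero}  f≤g = f≤g []
∑-mono-≤ {suc m} f≤g = +-mono-≤ (∑-mono-≤ (f≤g ∘ (false ∷_))) (∑-mono-≤ (f≤g ∘ (true ∷_)))

∑-mono-< : ∀ {m} {f g : Subset m → ℕ} → (∀ S → f S ≤ g S) → ∀ S → f S < g S → ∑ f < ∑ g
∑-mono-< {zero}  f≤g []          f<g = f<g
∑-mono-< {suc m} f≤g (false ∷ t) f<g =
  +-mono-<-≤ (∑-mono-< (f≤g ∘ (false ∷_)) t f<g) (∑-mono-≤ (f≤g ∘ (true ∷_)))
∑-mono-< {suc m} f≤g (true ∷ t)  f<g =
  +-mono-≤-< (∑-mono-≤ (f≤g ∘ (false ∷_))) (∑-mono-< (f≤g ∘ (true ∷_)) t f<g)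

∑-+ : ∀ {m} (f g : Subset m → ℕ) → ∑ (λ S → f S + g S) ≡ ∑ f + ∑ g
∑-+ {zero}  f g = refl
∑-+ {suc m} f g = begin
  ∑ (λ t → f (false ∷ t) + g (false ∷ t)) + ∑ (λ t → f (true ∷ t) + g (true ∷ t))
    ≡⟨ cong₂ _+_ (∑-+ (f ∘ (false ∷_)) (g ∘ (false ∷_))) (∑-+ (f ∘ (true ∷_)) (g ∘ (true ∷_))) ⟩
  (∑ (f ∘ (false ∷_)) + ∑ (g ∘ (false ∷_))) + (∑ (f ∘ (true ∷_)) + ∑ (g ∘ (true ∷_)))
    ≡⟨ interchange (∑ (f ∘ (false ∷_))) (∑ (g ∘ (false ∷_))) (∑ (f ∘ (true ∷_))) (∑ (g ∘ (true ∷_))) ⟩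
  ∑ f + ∑ g
    ∎
  where open ≡-Reasoning

∑-zero : ∀ {m} → ∑ {m} (λ _ → 0) ≡ 0
∑-zero {zero}  = refl
∑-zero {suc m} = cong₂ _+_ (∑-zero {m}) (∑-zero {m})

∑-insertAt : ∀ {m} (j : Fin (suc m)) (f : Subset (suc m) → ℕ) →
             ∑ f ≡ ∑ (λ t → f (insertAt t j false) + f (insertAt t j true))
∑-insertAt         zero    f = sym (∑-+ (f ∘ (false ∷_)) (f ∘ (true ∷_)))
∑-insertAt {suc m} (suc j) f = cong₂ _+_ (∑-insertAt j (f ∘ (false ∷_))) (∑-insertAt j (f ∘ (true ∷_)))

∑-∁ : ∀ {m} (f : Subset m → ℕ) → ∑ (f ∘ ∁) ≡ ∑ f
∑-∁ {zero}  f = refl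
∑-∁ {suc m} f =
  trans (cong₂ _+_ (∑-∁ (f ∘ (true ∷_))) (∑-∁ (f ∘ (false ∷_))))
        (+-comm (∑ (f ∘ (true ∷_))) (∑ (f ∘ (false ∷_))))

Family : ℕ → Set
Family m = Subset m → Bool

_∈ᶠ_ : ∀ {m} → Subset m → Family m → Set
S ∈ᶠ F = T (F S)

_⊆ᶠ_ : ∀ {m} → Family m → Family m → Set
F ⊆ᶠ G = ∀ S → S ∈ᶠ F → S ∈ᶠ G

_∪ᶠ_ : ∀ {m} → Family m → Family m → Family m
(F ∪ᶠ G) S = F S ∨ G S

Disjoint : ∀ {m} → Family m → Family m → Set
Disjoint F G = ∀ S → S ∈ᶠ F → S ∈ᶠ G → ⊥

Uniform : ∀ {m} → ℕ → Family m → Set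
Uniform a F = ∀ S → S ∈ᶠ F → ∣ S ∣ ≡ a

layer : ∀ {m} → ℕ → Family m
layer p S = ∣ S ∣ ≡ᵇ p

deletion link : ∀ {m} → Family (suc m) → Family m
deletion F t = F (false ∷ t)
link     F t = F (true ∷ t)

bit : Bool → ℕ
bit b = if b then 1 else 0

#_ : ∀ {m} → Family m → ℕ
# F = ∑ (bit ∘ F)

bit-mono : ∀ x y → (T x → T y) → bit x ≤ bit y
bit-mono false _     _   = z≤n
bit-mono true  true  _   = ≤-refl
bit-mono true  false x⇒y = ⊥-elim (x⇒y _)

bit-< : ∀ x y → ¬ T x → T y → bit x < bit y
bit-< false true  _  _ = s≤s z≤n
bit-< true  _     ¬x _ = ⊥-elim (¬x _)

bit-∨ : ∀ x y → ¬ (T x × T y) → bit (x ∨ y) ≡ bit x + bit y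
bit-∨ true  true  ¬x∧y = ⊥-elim (¬x∧y _)
bit-∨ true  false _    = refl
bit-∨ false y     _    = refl

#-mono : ∀ {m} {F G : Family m} → F ⊆ᶠ G → # F ≤ # G
#-mono {F = F} {G} F⊆G = ∑-mono-≤ (λ S → bit-mono (F S) (G S) (F⊆G S))

#-∪ : ∀ {m} {F G : Family m} → Disjoint F G → # (F ∪ᶠ G) ≡ # F + # G
#-∪ {F = F} {G} F∩G=∅ =
  trans (∑-cong (λ S → bit-∨ (F S) (G S) (λ (p , q) → F∩G=∅ S p q))) (∑-+ (bit ∘ F) (bit ∘ G))

#-empty : ∀ {m} {F : Family m} → (∀ S → ¬ S ∈ᶠ F) → # F ≡ 0
#-empty {m} {F} F=∅ = trans (∑-cong (λ S → bit-absent (F S) (F=∅ S))) (∑-zero {m})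
  where
  bit-absent : ∀ x → ¬ T x → bit x ≡ 0
  bit-absent false _  = refl
  bit-absent true  ¬x = ⊥-elim (¬x _)

member⇒#-pos : ∀ {m} (F : Family m) S → S ∈ᶠ F → 0 < # F
member⇒#-pos {m} F S S∈F =
  subst (_< # F) (∑-zero {m}) (∑-mono-< (λ _ → z≤n) S (bit-mono true (F S) (λ _ → S∈F)))

#-pos⇒member : ∀ {m} (F : Family m) → 0 < # F → ∃ λ S → S ∈ᶠ F
#-pos⇒member {zero} F 0<#F with F [] in F[]
... | true  = [] , subst T (sym F[]) _
... | false = ⊥-elim (<-irrefl refl 0<#F)
#-pos⇒member {suc m} F 0<#F with 0 <? # deletion F
... | yes 0<#F₀ = let (t , t∈F₀) = #-pos⇒member (deletion F) 0<#F₀ in false ∷ t , t∈F₀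
... | no  0≮#F₀ = let (t , t∈F₁) = #-pos⇒member (link F) 0<#F₁ in true ∷ t , t∈F₁
  where
  0<#F₁ : 0 < # link F
  0<#F₁ = subst (λ x → 0 < x + # link F) (n≤0⇒n≡0 (≮⇒≥ 0≮#F₀)) 0<#F

#-layer : ∀ m p → # layer {m} p ≡ m C p
#-layer zero    zero    = refl
#-layer zero    (suc p) = refl
#-layer (suc m) zero    = cong₂ _+_ (#-layer m zero) (∑-zero {m})
#-layer (suc m) (suc p) = begin
  # layer {m} (suc p) + # layer {m} p  ≡⟨ cong₂ _+_ (#-layer m (suc p)) (#-layer m p) ⟩
  m C suc p + m C p                    ≡⟨ +-comm (m C suc p) (m C p) ⟩
  m C p + m C suc p                    ≡⟨ nCk+nC[k+1]≡[n+1]C[k+1] m p ⟩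
  suc m C suc p                        ∎
  where open ≡-Reasoning

#-uniform-≤ : ∀ {m p} {F : Family m} → Uniform p F → # F ≤ m C p
#-uniform-≤ {m} {p} {F} F-unif = begin
  # F            ≤⟨ #-mono {F = F} {layer p} (λ S S∈F → ≡⇒≡ᵇ ∣ S ∣ p (F-unif S S∈F)) ⟩
  # layer {m} p  ≡⟨ #-layer m p ⟩
  m C p          ∎
  where open ≤-Reasoning

#-disjoint-uniform : ∀ {m p} {F G : Family m} → Uniform p F → Uniform p G → Disjoint F G →
                     # F + # G ≤ m C p
#-disjoint-uniform {m} {p} {F} {G} F-unif G-unif F∩G=∅ =
  subst (_≤ m C p) (#-∪ {F = F} F∩G=∅) (#-uniform-≤ ∪-unif)
  where
  ∪-unif : Uniform p (F ∪ᶠ G)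
  ∪-unif S S∈F∪G with to T-∨ S∈F∪G
  ... | inj₁ S∈F = F-unif S S∈F
  ... | inj₂ S∈G = G-unif S S∈G

deletion-uniform : ∀ {m a} {F : Family (suc m)} → Uniform a F → Uniform a (deletion F)
deletion-uniform F-unif t = F-unif (false ∷ t)

link-uniform : ∀ {m a} {F : Family (suc m)} → Uniform (suc a) F → Uniform a (link F)
link-uniform F-unif t t∈F₁ = suc-injective (F-unif (true ∷ t) t∈F₁)

∘∁-uniform : ∀ {m k} {F : Family m} → Uniform k F → Uniform (m ∸ k) (F ∘ ∁)
∘∁-uniform {m} F-unif S ∁S∈F =
  trans (sym (m∸[m∸n]≡n (∣p∣≤n S))) (cong (m ∸_) (trans (sym (∣∁p∣≡n∸∣p∣ S)) (F-unif (∁ S) ∁S∈F)))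

∂ : ∀ {m} → Family m → Family m
∂ {zero}  F []      = false
∂ {suc m} F (h ∷ t) = (not h ∧ F (true ∷ t)) ∨ ∂ (λ u → F (h ∷ u)) t

∂-intro : ∀ {m} {F : Family m} S i → lookup S i ≡ false → (S [ i ]≔ true) ∈ᶠ F → S ∈ᶠ ∂ F
∂-intro (false ∷ t) zero    refl S+i∈F = from T-∨ (inj₁ S+i∈F)
∂-intro (h     ∷ t) (suc i) tᵢ   S+i∈F = from T-∨ (inj₂ (∂-intro t i tᵢ S+i∈F))

∂-elim : ∀ {m} {F : Family m} S → S ∈ᶠ ∂ F → ∃ λ i → lookup S i ≡ false × (S [ i ]≔ true) ∈ᶠ F
∂-elim (false ∷ t) S∈∂F with to T-∨ S∈∂F
... | inj₁ t+0∈F = zero , refl , t+0∈F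
... | inj₂ t∈∂F  = let (i , tᵢ , t+i∈F) = ∂-elim t t∈∂F in suc i , tᵢ , t+i∈F
∂-elim (true  ∷ t) S∈∂F = let (i , tᵢ , t+i∈F) = ∂-elim t S∈∂F in suc i , tᵢ , t+i∈F

∂-uniform : ∀ {m a} {F : Family m} → Uniform (suc a) F → Uniform a (∂ F)
∂-uniform F-unif S S∈∂F =
  let (i , Sᵢ , S+i∈F) = ∂-elim S S∈∂F
  in suc-injective (trans (sym (∣p[i]≔true∣ S i Sᵢ)) (F-unif _ S+i∈F))

∂-nonempty : ∀ {m a} {F : Family m} → Uniform (suc a) F → 0 < # F → 0 < # ∂ F
∂-nonempty {F = F} F-unif 0<#F =
  let (S , S∈F) = #-pos⇒member F 0<#F
      (i , Sᵢ)  = ∣p∣≡1+n⇒lookup S (F-unif S S∈F)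
  in member⇒#-pos (∂ F) (S [ i ]≔ false)
       (∂-intro (S [ i ]≔ false) i (lookup∘update i S false)
         (subst (_∈ᶠ F) (sym ([]≔-restore S i Sᵢ)) S∈F))

∂^ : ∀ {m} → ℕ → Family m → Family m
∂^ zero    F = F
∂^ (suc d) F = ∂^ d (∂ F)

∂^-uniform : ∀ {m c} d {F : Family m} → Uniform (d + c) F → Uniform c (∂^ d F)
∂^-uniform zero    F-unif = F-unif
∂^-uniform (suc d) F-unif = ∂^-uniform d (∂-uniform F-unif)

∂^-⊆ : ∀ {m} d (F : Family m) S → S ∈ᶠ ∂^ d F → ∃ λ U → U ∈ᶠ F × S ⊆ U
∂^-⊆ zero    F S S∈F   = S , S∈F , id
∂^-⊆ (suc d) F S S∈∂^F =
  let (U , U∈∂F , S⊆U) = ∂^-⊆ d (∂ F) S S∈∂^F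
      (i , Uᵢ , U+i∈F) = ∂-elim U U∈∂F
  in U [ i ]≔ true , U+i∈F , p⊆p[i]≔true U i ∘ S⊆U

-- Compression and shifting

-- The compression of j into 0: a member t with j ∈ t and 0 ∉ t is replaced by t - j + 0,
-- unless t - j + 0 is already a member.
compress : ∀ {m} → Fin m → Family (suc m) → Family (suc m)
compress j F (false ∷ t) = if lookup t j then F (false ∷ t) ∧ F (true ∷ t [ j ]≔ false) else F (false ∷ t)
compress j F (true  ∷ t) = if lookup t j then F (true ∷ t) else F (true ∷ t) ∨ F (false ∷ t [ j ]≔ true)

module _ {m} (j : Fin m) (F : Family (suc m)) where

  compress-intro₀ : ∀ t → (false ∷ t) ∈ᶠ F → (lookup t j ≡ true → (true ∷ t [ j ]≔ false) ∈ᶠ F) →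
                    (false ∷ t) ∈ᶠ compress j F
  compress-intro₀ t t∈F moved∈F with lookup t j
  ... | true  = from T-∧ (t∈F , moved∈F refl)
  ... | false = t∈F

  compress-elim₀ : ∀ t → (false ∷ t) ∈ᶠ compress j F →
                   (false ∷ t) ∈ᶠ F × (lookup t j ≡ true → (true ∷ t [ j ]≔ false) ∈ᶠ F)
  compress-elim₀ t t∈SF with lookup t j
  ... | true  = let (t∈F , moved∈F) = to T-∧ t∈SF in t∈F , λ _ → moved∈F
  ... | false = t∈SF , λ ()

  compress-intro₁ : ∀ t → (true ∷ t) ∈ᶠ F ⊎ (lookup t j ≡ false × (false ∷ t [ j ]≔ true) ∈ᶠ F) →
                    (true ∷ t) ∈ᶠ compress j F
  compress-intro₁ t t∈F⊎moved with lookup t j | t∈F⊎moved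
  ... | true  | inj₁ t∈F         = t∈F
  ... | true  | inj₂ (() , _)
  ... | false | inj₁ t∈F         = from T-∨ (inj₁ t∈F)
  ... | false | inj₂ (_ , t+j∈F) = from T-∨ (inj₂ t+j∈F)

  compress-elim₁ : ∀ t → (true ∷ t) ∈ᶠ compress j F →
                   (true ∷ t) ∈ᶠ F ⊎ (lookup t j ≡ false × (false ∷ t [ j ]≔ true) ∈ᶠ F)
  compress-elim₁ t t∈SF with lookup t j
  ... | true  = inj₁ t∈SF
  ... | false = map₂ (refl ,_) (to T-∨ t∈SF)

compress-uniform : ∀ {m a} j (F : Family (suc m)) → Uniform a F → Uniform a (compress j F)
compress-uniform j F F-unif (false ∷ t) t∈SF = F-unif _ (proj₁ (compress-elim₀ j F t t∈SF))
compress-uniform j F F-unif (true  ∷ t) t∈SF with compress-elim₁ j F t t∈SF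
... | inj₁ t∈F            = F-unif _ t∈F
... | inj₂ (tⱼ , t+j∈F) = trans (sym (∣p[i]≔true∣ t j tⱼ)) (F-unif _ t+j∈F)

bit-∨∧-exchange : ∀ a b c d → a + bit (b ∨ c) + (bit (c ∧ b) + d) ≡ a + bit b + (bit c + d)
bit-∨∧-exchange a true  true  d = refl
bit-∨∧-exchange a true  false d = refl
bit-∨∧-exchange a false true  d = trans (+-assoc a 1 d) (cong (_+ suc d) (sym (+-identityʳ a)))
bit-∨∧-exchange a false false d = refl

-- Grouping the subsets into quadruples by their membership of 0 and of j, the compression
-- acts inside each quadruple u, u + 0, u + j, u + 0 + j, where it can only replace u + j by u + 0.
#-compress : ∀ {m} j (F : Family (suc m)) → # compress j F ≡ # F
#-compress {suc m} j F = begin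
  # compress j F                   ≡⟨ by-quadruples (compress j F) ⟩
  ∑ (quadruple (compress j F))     ≡⟨ ∑-cong quadruple-preserved ⟩
  ∑ (quadruple F)                  ≡⟨ by-quadruples F ⟨
  # F                              ∎
  where
  open ≡-Reasoning
  pair : Family (suc (suc m)) → Subset (suc m) → ℕ
  pair X t = bit (X (false ∷ t)) + bit (X (true ∷ t))
  quadruple : Family (suc (suc m)) → Subset m → ℕ
  quadruple X u = pair X (insertAt u j false) + pair X (insertAt u j true)
  by-quadruples : ∀ X → # X ≡ ∑ (quadruple X)
  by-quadruples X = trans (sym (∑-+ (bit ∘ deletion X) (bit ∘ link X))) (∑-insertAt j (pair X))
  quadruple-preserved : ∀ u → quadruple (compress j F) u ≡ quadruple F u
  quadruple-preserved u
    rewrite insertAt-lookup u j false | insertAt-lookup u j true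
          | insertAt-[]≔ u j {false} {true} | insertAt-[]≔ u j {true} {false}
    = bit-∨∧-exchange (bit (F (false ∷ insertAt u j false))) (F (true ∷ insertAt u j false))
                      (F (false ∷ insertAt u j true)) (bit (F (true ∷ insertAt u j true)))

#-link-compress : ∀ {m} j (F : Family (suc m)) t → lookup t j ≡ true → (false ∷ t) ∈ᶠ F →
                  ¬ (true ∷ t [ j ]≔ false) ∈ᶠ F → # link F < # link (compress j F)
#-link-compress j F t tⱼ t∈F moved∉F =
  ∑-mono-< (λ u → bit-mono (F (true ∷ u)) _ (compress-intro₁ j F u ∘ inj₁)) (t [ j ]≔ false)
    (bit-< (F (true ∷ t [ j ]≔ false)) _ moved∉F
      (compress-intro₁ j F (t [ j ]≔ false)
        (inj₂ (lookup∘update j t false , subst (λ u → (false ∷ u) ∈ᶠ F) (sym ([]≔-restore t j tⱼ)) t∈F))))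

∂-compress : ∀ {m} j (F : Family (suc m)) → ∂ (compress j F) ⊆ᶠ compress j (∂ F)
∂-compress j F S S∈∂SF = let (i , Sᵢ , S+i∈SF) = ∂-elim S S∈∂SF in from-added S i Sᵢ S+i∈SF
  where
  from-added : ∀ S i → lookup S i ≡ false → (S [ i ]≔ true) ∈ᶠ compress j F → S ∈ᶠ compress j (∂ F)
  from-added (false ∷ t) zero refl t+0∈SF with compress-elim₁ j F t t+0∈SF
  ... | inj₁ t+0∈F =
    compress-intro₀ j (∂ F) t (∂-intro {F = F} (false ∷ t) zero refl t+0∈F) λ tⱼ →
      ∂-intro {F = F} (true ∷ t [ j ]≔ false) (suc j) (lookup∘update j t false)
        (subst (λ u → (true ∷ u) ∈ᶠ F) (sym ([]≔-restore t j tⱼ)) t+0∈F)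
  ... | inj₂ (tⱼ , t+j∈F) =
    compress-intro₀ j (∂ F) t (∂-intro {F = F} (false ∷ t) (suc j) tⱼ t+j∈F) λ tⱼ′ →
      ⊥-elim (≢-by-lookup t tⱼ tⱼ′ refl)
  from-added (false ∷ t) (suc y) t_y t+y∈SF =
    let (t+y∈F , moved∈F) = compress-elim₀ j F (t [ y ]≔ true) t+y∈SF in
    compress-intro₀ j (∂ F) t (∂-intro {F = F} (false ∷ t) (suc y) t_y t+y∈F) λ tⱼ →
      let y≢j = ≢-by-lookup t t_y tⱼ in
      ∂-intro {F = F} (true ∷ t [ j ]≔ false) (suc y) (trans (lookup∘update′ y≢j t false) t_y)
        (subst (λ u → (true ∷ u) ∈ᶠ F) ([]≔-commutes t y j y≢j)
          (moved∈F (trans (lookup∘update′ (y≢j ∘ sym) t true) tⱼ)))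
  from-added (true ∷ t) (suc y) t_y t+y∈SF with compress-elim₁ j F (t [ y ]≔ true) t+y∈SF
  ... | inj₁ t+y∈F = compress-intro₁ j (∂ F) t (inj₁ (∂-intro {F = F} (true ∷ t) (suc y) t_y t+y∈F))
  ... | inj₂ (t+yⱼ , t+y+j∈F) =
    let y≢j = ≢-by-lookup (t [ y ]≔ true) t+yⱼ (lookup∘update y t true) ∘ sym
        tⱼ  = trans (sym (lookup∘update′ (y≢j ∘ sym) t true)) t+yⱼ
    in compress-intro₁ j (∂ F) t (inj₂ (tⱼ ,
         ∂-intro {F = F} (false ∷ t [ j ]≔ true) (suc y) (trans (lookup∘update′ y≢j t true) t_y)
           (subst (λ u → (false ∷ u) ∈ᶠ F) ([]≔-commutes t y j y≢j) t+y+j∈F)))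

Shifted : ∀ {m} → Family (suc m) → Set
Shifted F = ∀ t j → lookup t j ≡ true → (false ∷ t) ∈ᶠ F → (true ∷ t [ j ]≔ false) ∈ᶠ F

ShiftingOf : ∀ {m} → ℕ → Family (suc m) → Set
ShiftingOf {m} a F = ∃ λ (G : Family (suc m)) → Shifted G × Uniform a G × # G ≡ # F × # ∂ G ≤ # ∂ F

-- A compression that enlarges the link shrinks the deletion, which bounds the number of
-- such steps; once none enlarges the link, the family is shifted.
shift : ∀ {m a} (F : Family (suc m)) → Uniform a F → ShiftingOf a F
shift F = go F (<-wellFounded (# deletion F))
  where
  go : ∀ {m a} (F : Family (suc m)) → Acc _<_ (# deletion F) → Uniform a F → ShiftingOf a F
  go F (acc smaller) F-unif with Fin.any? (λ j → # link F <? # link (compress j F))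
  ... | no  no-growth = F , shifted , F-unif , refl , ≤-refl
    where
    shifted : Shifted F
    shifted t j tⱼ t∈F = decidable-stable (T? _) λ moved∉F →
      no-growth (j , #-link-compress j F t tⱼ t∈F moved∉F)
  ... | yes (j , growth) =
    let (G , G-shifted , G-unif , #G≡#SF , #∂G≤#∂SF) =
          go (compress j F) (smaller deletion-shrinks) (compress-uniform j F F-unif)
    in G , G-shifted , G-unif , trans #G≡#SF (#-compress j F) ,
       ≤-trans #∂G≤#∂SF (≤-trans (#-mono (∂-compress j F)) (≤-reflexive (#-compress j (∂ F))))
    where
    deletion-shrinks : # deletion (compress j F) < # deletion F
    deletion-shrinks = +-cancelʳ-< (# link F) _ _
      (<-≤-trans (+-monoʳ-< (# deletion (compress j F)) growth) (≤-reflexive (#-compress j F)))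

∂-deletion⊆link : ∀ {m} (G : Family (suc m)) → Shifted G → ∂ (deletion G) ⊆ᶠ link G
∂-deletion⊆link G G-shifted t t∈∂G₀ =
  let (i , tᵢ , t+i∈G₀) = ∂-elim t t∈∂G₀ in
  subst (λ u → (true ∷ u) ∈ᶠ G) ([]≔-restore t i tᵢ)
    (G-shifted (t [ i ]≔ true) i (lookup∘update i t true) t+i∈G₀)

∨-absorbʳ : ∀ x y → (T y → T x) → x ∨ y ≡ x
∨-absorbʳ true  _     _   = refl
∨-absorbʳ false true  y⇒x = ⊥-elim (y⇒x _)
∨-absorbʳ false false _   = refl

#∂-shifted : ∀ {m} (G : Family (suc m)) → Shifted G → # ∂ G ≡ # link G + # ∂ (link G)
#∂-shifted G G-shifted =
  cong (_+ # ∂ (link G))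
    (∑-cong λ t → cong bit (∨-absorbʳ (G (true ∷ t)) _ (∂-deletion⊆link G G-shifted t)))

-- Lovász's form of the Kruskal–Katona theorem

-- For a shifted G, ∂G is link G (the sets without 0) together with ∂(link G)
-- (with 0 added back). If link G is large, Pascal's rule concludes; otherwise deletion G is
-- large, and its shadow, which lies inside link G, would be larger than link G.
mutual
  lovász : ∀ m a y {F : Family m} → Uniform (2 + a) F → y C (2 + a) < # F → y C (1 + a) < # ∂ F
  lovász m       a zero    F-unif y<#F = ∂-nonempty F-unif y<#F
  lovász zero    a (suc y) F-unif y<#F = ⊥-elim (n≮0 (<-≤-trans y<#F (#-uniform-≤ F-unif)))
  lovász (suc m) a (suc y) {F} F-unif y<#F =
    let (G , G-shifted , G-unif , #G≡#F , #∂G≤#∂F) = shift F F-unif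
    in <-≤-trans (lovász-shifted m a y G G-shifted G-unif (subst (suc y C (2 + a) <_) (sym #G≡#F) y<#F))
                 #∂G≤#∂F

  lovász-≤ : ∀ m a y {F : Family m} → Uniform (1 + a) F → y C (1 + a) < # F → y C a ≤ # ∂ F
  lovász-≤ m zero    y F-unif y<#F = ∂-nonempty F-unif (≤-<-trans z≤n y<#F)
  lovász-≤ m (suc a) y F-unif y<#F = <⇒≤ (lovász m a y F-unif y<#F)

  lovász-shifted : ∀ m a y (G : Family (suc m)) → Shifted G → Uniform (2 + a) G →
                   suc y C (2 + a) < # G → suc y C (1 + a) < # ∂ G
  lovász-shifted m a y G G-shifted G-unif y<#G with y C (1 + a) <? # link G
  ... | yes y<#G₁ = begin-strict
    suc y C (1 + a)             ≡⟨ nCk+nC[k+1]≡[n+1]C[k+1] y a ⟨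
    y C a + y C (1 + a)         ≡⟨ +-comm (y C a) _ ⟩
    y C (1 + a) + y C a         <⟨ +-mono-<-≤ y<#G₁ (lovász-≤ m a y (link-uniform G-unif) y<#G₁) ⟩
    # link G + # ∂ (link G)     ≡⟨ #∂-shifted G G-shifted ⟨
    # ∂ G                       ∎
    where open ≤-Reasoning
  ... | no  y≮#G₁ = ⊥-elim (<-irrefl refl (begin-strict
    y C (1 + a)                 <⟨ lovász m a y (deletion-uniform G-unif) y<#G₀ ⟩
    # ∂ (deletion G)            ≤⟨ #-mono (∂-deletion⊆link G G-shifted) ⟩
    # link G                    ≤⟨ ≮⇒≥ y≮#G₁ ⟩
    y C (1 + a)                 ∎))
    where
    open ≤-Reasoning
    y<#G₀ : y C (2 + a) < # deletion G
    y<#G₀ = +-cancelʳ-< (y C (1 + a)) _ _ (begin-strict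
      y C (2 + a) + y C (1 + a)   ≡⟨ +-comm (y C (2 + a)) _ ⟩
      y C (1 + a) + y C (2 + a)   ≡⟨ nCk+nC[k+1]≡[n+1]C[k+1] y (1 + a) ⟩
      suc y C (2 + a)             <⟨ y<#G ⟩
      # deletion G + # link G     ≤⟨ +-monoʳ-≤ (# deletion G) (≮⇒≥ y≮#G₁) ⟩
      # deletion G + y C (1 + a)  ∎)

lovász-iterated : ∀ m d c y {F : Family m} → Uniform (d + suc c) F → y C (d + suc c) < # F →
                  y C suc c < # ∂^ d F
lovász-iterated m zero    c y F-unif y<#F = y<#F
lovász-iterated m (suc d) c y {F} F-unif y<#F =
  lovász-iterated m d c y (∂-uniform F-unif) (one-step (+-suc d c) F-unif y<#F)
  where
  one-step : ∀ {a b} → a ≡ suc b → Uniform (suc a) F → y C suc a < # F → y C a < # ∂ F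
  one-step refl = lovász m _ y

Avoids : ∀ {m} → Family m → Family m → Set
Avoids A F = ∀ S U → S ∈ᶠ A → U ∈ᶠ F → ¬ S ⊆ U

-- A is disjoint from the shadow ∂^d F, which Lovász's theorem makes large.
avoiding-family-bound : ∀ {m c d y} {A F : Family m} → Uniform (suc c) A → Uniform (d + suc c) F →
                        Avoids A F → y C (d + suc c) < # F → y C suc c + # A < m C suc c
avoiding-family-bound {m} {c} {d} {y} {A} {F} A-unif F-unif A-avoids-F y<#F = begin-strict
  y C suc c + # A   <⟨ +-monoˡ-< (# A) (lovász-iterated m d c y F-unif y<#F) ⟩
  # ∂^ d F + # A    ≤⟨ #-disjoint-uniform (∂^-uniform d F-unif) A-unif disjoint ⟩
  m C suc c         ∎
  where
  open ≤-Reasoning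
  disjoint : Disjoint (∂^ d F) A
  disjoint S S∈∂^F S∈A = let (U , U∈F , S⊆U) = ∂^-⊆ d F S S∈∂^F in A-avoids-F S U S∈A U∈F S⊆U

avoided-family-bound : ∀ {m c a y} {A F : Family m} → Uniform (suc c) A → Uniform a F → suc c ≤ a →
                       Avoids A F → m C suc c ∸ y C suc c ≤ # A → # F ≤ y C a
avoided-family-bound {m} {c} {a} {y} {A} {F} A-unif F-unif c<a A-avoids-F A-large with y C a <? # F
... | no  y≮#F = ≮⇒≥ y≮#F
... | yes y<#F = ⊥-elim (<-irrefl refl (begin-strict
  m C suc c                            ≤⟨ m≤n+m∸n (m C suc c) (y C suc c) ⟩
  y C suc c + (m C suc c ∸ y C suc c)  ≤⟨ +-monoʳ-≤ (y C suc c) A-large ⟩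
  y C suc c + # A                      <⟨ avoiding-family-bound A-unif F-unif′ A-avoids-F y<#F′ ⟩
  m C suc c                            ∎))
  where
  open ≤-Reasoning
  a≡d+c : a ≡ (a ∸ suc c) + suc c
  a≡d+c = sym (m∸n+n≡m c<a)
  F-unif′ : Uniform ((a ∸ suc c) + suc c) F
  F-unif′ = subst (λ k → Uniform k F) a≡d+c F-unif
  y<#F′ : y C ((a ∸ suc c) + suc c) < # F
  y<#F′ = subst (λ k → y C k < # F) a≡d+c y<#F

witness : ∀ {p} {P : Set p} (P? : Dec P) → T (does P?) → P
witness (yes p) _ = p
witness (no _)  ()

_≟ˢ_ : ∀ {n} → DecidableEquality (Subset n)
_≟ˢ_ = ≡-dec Bool._≟_

listFamily : ∀ {n} → List (Subset n) → Family n
listFamily xs S = does (Any.any? (S ≟ˢ_) xs)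

listFamily⇒∈ : ∀ {n} {xs : List (Subset n)} S → S ∈ᶠ listFamily xs → S ∈ₗ xs
listFamily⇒∈ {xs = xs} S = witness (Any.any? (S ≟ˢ_) xs)

#-singleton : ∀ {n} (x : Subset n) → # (λ S → does (S ≟ˢ x)) ≡ 1
#-singleton         []          = refl
#-singleton {suc n} (false ∷ x) = cong₂ _+_ (#-singleton x) (∑-zero {n})
#-singleton {suc n} (true  ∷ x) = cong₂ _+_ (∑-zero {n}) (#-singleton x)

length≡#listFamily : ∀ {n} (xs : List (Subset n)) → Unique xs → length xs ≡ # listFamily xs
length≡#listFamily {n} []       []                 = sym (∑-zero {n})
length≡#listFamily     (x ∷ xs) (x∉xs ∷ xs-unique) = sym (begin
  # listFamily (x ∷ xs)                       ≡⟨ #-∪ {F = λ S → does (S ≟ˢ x)} disjoint ⟩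
  # (λ S → does (S ≟ˢ x)) + # listFamily xs   ≡⟨ cong₂ _+_ (#-singleton x) (sym (length≡#listFamily xs xs-unique)) ⟩
  suc (length xs)                             ∎)
  where
  open ≡-Reasoning
  disjoint : Disjoint (λ S → does (S ≟ˢ x)) (listFamily xs)
  disjoint S S≡x S∈xs = All.lookup x∉xs (listFamily⇒∈ S S∈xs) (sym (witness (S ≟ˢ x) S≡x))

-- The members of a family in binom([2,n], j) avoid index zero (the element 1), so the family
-- is determined by the tails of its members, a family on [2,n].
tails : ∀ {m} → List (Subset (suc m)) → Family m
tails xs = deletion (listFamily xs)

module _ {m j} {xs : List (Subset (suc m))} (xs-fam : FamilyIn (suc m) j xs) where

  length≡#tails : length xs ≡ # tails xs
  length≡#tails = begin
    length xs                            ≡⟨ length≡#listFamily xs (proj₁ xs-fam) ⟩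
    # tails xs + # link (listFamily xs)  ≡⟨ cong (# tails xs +_) (#-empty {F = link (listFamily xs)} avoids-zero) ⟩
    # tails xs + 0                       ≡⟨ +-identityʳ (# tails xs) ⟩
    # tails xs                           ∎
    where
    open ≡-Reasoning
    avoids-zero : ∀ t → ¬ t ∈ᶠ link (listFamily xs)
    avoids-zero t t∈ with () ← proj₁ (All.lookup (proj₂ xs-fam) (listFamily⇒∈ (true ∷ t) t∈)) zero here

  tails-uniform : Uniform j (tails xs)
  tails-uniform t t∈ = proj₂ (All.lookup (proj₂ xs-fam) (listFamily⇒∈ (false ∷ t) t∈))

cross-intersecting⇒avoids : ∀ {m} {𝒜 ℬ : List (Subset (suc m))} → CrossIntersecting 𝒜 ℬ →
                            Avoids (tails 𝒜) (tails ℬ ∘ ∁)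
cross-intersecting⇒avoids cross S U S∈𝒜 ∁U∈ℬ S⊆U
  with cross (listFamily⇒∈ (false ∷ S) S∈𝒜) (listFamily⇒∈ (false ∷ ∁ U) ∁U∈ℬ)
... | suc i , there i∈S∩∁U = let (i∈S , i∈∁U) = x∈p∩q⁻ S (∁ U) i∈S∩∁U in x∈∁p⇒x∉p i∈∁U (S⊆U i∈S)

C-symmetric : ∀ {n} i j → i + j ≡ n → n C i ≡ n C j
C-symmetric i j refl = trans (nCk≡nC[n∸k] (m≤m+n i j)) (cong ((i + j) C_) (m+n∸m≡n i j))

1+m∸r≡[k∸r+1]+[m∸k] : ∀ {r k m} → r ≤ k → k ≤ m → suc m ∸ r ≡ (k ∸ r + 1) + (m ∸ k)
1+m∸r≡[k∸r+1]+[m∸k] {r} {k} {m} r≤k k≤m = trans (cong (_∸ r) (sym r+[k∸r+1]+[m∸k]≡1+m)) (m+n∸m≡n r _)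
  where
  open ≡-Reasoning
  r+[k∸r+1]+[m∸k]≡1+m : r + ((k ∸ r + 1) + (m ∸ k)) ≡ suc m
  r+[k∸r+1]+[m∸k]≡1+m = begin
    r + ((k ∸ r + 1) + (m ∸ k))  ≡⟨ cong (λ x → r + (x + (m ∸ k))) (+-comm (k ∸ r) 1) ⟩
    r + suc (k ∸ r + (m ∸ k))    ≡⟨ +-suc r _ ⟩
    suc (r + (k ∸ r + (m ∸ k)))  ≡⟨ cong suc (+-assoc r (k ∸ r) (m ∸ k)) ⟨
    suc (r + (k ∸ r) + (m ∸ k))  ≡⟨ cong (λ x → suc (x + (m ∸ k))) (m+[n∸m]≡n r≤k) ⟩
    suc (k + (m ∸ k))            ≡⟨ cong suc (m+[n∸m]≡n k≤m) ⟩
    suc m                        ∎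

corollary2p5 : (r n k : ℕ) → 3 ≤ r → 2 * k < n → r ≤ k →
    (𝒜 ℬ : List (Subset n)) →
    FamilyIn n (k ∸ 1) 𝒜 → FamilyIn n k ℬ → CrossIntersecting 𝒜 ℬ →
    (n ∸ 1) C (k ∸ 1) ∸ (n ∸ r) C (k ∸ 1) ≤ length 𝒜 →
    length ℬ ≤ (n ∸ r) C (k ∸ r + 1)
-- From 3 ≤ r only k ≥ 2 is needed, so that the members of 𝒜 are nonempty.
corollary2p5 _ zero    _                _             ()
corollary2p5 _ (suc m) zero             (s≤s _)       _    ()
corollary2p5 _ (suc m) (suc zero)       (s≤s (s≤s _)) _    (s≤s ())
corollary2p5 r (suc m) k@(suc (suc c)) _             2k<n r≤k 𝒜 ℬ 𝒜-fam ℬ-fam cross 𝒜-large = begin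
  length ℬ          ≡⟨ length≡#tails ℬ-fam ⟩
  # tails ℬ         ≡⟨ ∑-∁ (bit ∘ tails ℬ) ⟨
  # (tails ℬ ∘ ∁)   ≤⟨ avoided-family-bound (tails-uniform 𝒜-fam) (∘∁-uniform (tails-uniform ℬ-fam)) c<m∸k
                         (cross-intersecting⇒avoids cross) (subst (_ ≤_) (length≡#tails 𝒜-fam) 𝒜-large) ⟩
  y C (m ∸ k)       ≡⟨ C-symmetric (k ∸ r + 1) (m ∸ k) (sym (1+m∸r≡[k∸r+1]+[m∸k] r≤k k≤m)) ⟨
  y C (k ∸ r + 1)   ∎
  where
  open ≤-Reasoning
  y : ℕ
  y = suc m ∸ r
  k≤m∸k : k ≤ m ∸ k
  k≤m∸k = m+n≤o⇒m≤o∸n k (subst (_≤ m) (cong (k +_) (+-identityʳ k)) (s≤s⁻¹ 2k<n))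
  k≤m : k ≤ m
  k≤m = ≤-trans k≤m∸k (m∸n≤m m k)
  c<m∸k : suc c ≤ m ∸ k
  c<m∸k = ≤-trans (n≤1+n (suc c)) k≤m∸k
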